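{- Let $a,b$ be distinct positive integers and $X=\{a,b,a+b\}$. Then the nim sequence $\mathcal{G}_X$ of the all-but subtraction game with finite excluded subtraction set $X$ is purely arithmetic periodic: there exist integers $p\geq 1$ and $s\geq 0$ such that $\mathcal{G}_X(n+p)=\mathcal{G}_X(n)+s$ for all $n\geq 0$.
   Context: For a finite set $X$ of positive integers, the all-but subtraction game with finite excluded subtraction set $X$ is the subtraction game with subtraction set $S=\{1,2,3,\dots\}\setminus X$: a position is a heap of $n\geq 0$ counters, and a move removes $s$ counters for some $s\in S$ with $s\leq n$. Its nim sequence is defined by $\mathcal{G}_X(n)=\operatorname{mex}\{\mathcal{G}_X(n-s): s\in S,\ s\leq n\}$ for $n\geq 0$, where $\operatorname{mex}$ of a set of nonnegative integers is the least nonnegative integer not in it. -}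

module Defs where

open import Data.Nat using (ℕ; zero; suc; _+_; _∸_; _≟_)
open import Data.List using (List; []; _∷_; _++_; length; map; filter; lookup; reverse)
open import Data.List.Membership.DecPropositional _≟_ using (_∈?_)
open import Relation.Nullary using (¬?; does)
open import Data.Bool using (Bool; true; false; if_then_else_)

-- mex of a list of naturals: least natural not occurring in the list.
-- Search starting at k with fuel; fuel (length + 1) suffices.
mexFrom : ℕ → ℕ → List ℕ → ℕ
mexFrom zero    k xs = k
mexFrom (suc f) k xs = if does (k ∈? xs) then mexFrom f (suc k) xs else k

mex : List ℕ → ℕ
mex xs = mexFrom (suc (length xs)) 0 xs

oneTo : ℕ → List ℕ
oneTo zero    = []
oneTo (suc n) = oneTo n ++ (suc n ∷ [])

-- Given the list  prev = [G(n-1), G(n-2), ..., G(0)]  (so index (s-1) is G(n-s)),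
-- the options from a heap of n = length prev are G(n-s) for s ∈ {1..n}, s ∉ X.
nth : List ℕ → ℕ → ℕ
nth []       _       = 0
nth (x ∷ xs) zero    = x
nth (x ∷ xs) (suc i) = nth xs i

allowed : List ℕ → List ℕ → List ℕ
allowed X prev = filter (λ s → ¬? (s ∈? X)) (oneTo (length prev))

options : List ℕ → List ℕ → List ℕ
options X prev = map (λ s → nth prev (s ∸ 1)) (allowed X prev)

table : List ℕ → ℕ → List ℕ
table X zero    = []
table X (suc n) = mex (options X (table X n)) ∷ table X n

G : List ℕ → ℕ → ℕ
G X n = mex (options X (table X n))

-- Let a < b (the case b < a follows by symmetry of X) and write b = a + c.
--
-- If c = a, then X = {a, 2a, 3a} and G(w + (u + 4q)a) = w + qa for w < a and u < 4:
-- two heaps with the same value differ by ja with 1 ≤ j ≤ 3.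
--
-- If c ≠ a, every value of G is taken at exactly three heaps i < i + a or i + b < i + a + b,
-- whose pairwise distances are excluded moves. Labelling each heap by its role in its triple,
-- the labels follow a greedy rule reading the labels a + b, b, c and a heaps back, and G(n) is
-- the number of triples opened before the triple of n. The rule can also be run backwards,
-- reading a, c, b and a + b heaps ahead, so the labelling is a recurrence of order a + b in
-- both directions over four letters, hence purely periodic, say with period p. Then
-- G(n + p) = G(n) + s, where s is the number of triples opened below p.

module Submission where

open import Defs
open import Data.Nat using (ℕ; zero; suc; _+_; _*_; _∸_; _^_; _≤_; _<_; _≟_; _<?_; z≤n; s≤s; s≤s⁻¹; NonZero; >-nonZero⁻¹)
open import Data.Nat.Properties
open import Data.Nat.DivMod using (_/_; _%_; m≡m%n+[m/n]*n; m%n<n; [m+kn]%n≡m%n; m<n⇒m%n≡m)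
open import Data.Nat.Induction using (<-rec)
open import Data.Nat.Tactic.RingSolver using (solve-∀)
open import Algebra.Properties.CommutativeSemigroup +-commutativeSemigroup using (x∙yz≈y∙xz; xy∙z≈y∙xz)
open import Data.Fin using (Fin; zero; suc; toℕ; fromℕ<; funToFin; finToFun)
open import Data.Fin.Properties using (pigeonhole; toℕ<n; toℕ-fromℕ<; finToFun-funToFin) renaming (_≟_ to _≟ᶠ_)
open import Data.List using (List; []; _∷_; length; lookup)
open import Data.List.Membership.Propositional using (_∈_; _∉_)
open import Data.List.Membership.Propositional.Properties using (∈-filter⁺; ∈-filter⁻; ∈-map⁺; ∈-map⁻; ∈-++⁺ˡ; ∈-++⁺ʳ; ∈-++⁻)
open import Data.List.Membership.DecPropositional _≟_ using (_∈?_)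
open import Data.List.Relation.Binary.Subset.Propositional using (_⊆_)
open import Data.List.Relation.Unary.Any using (here; there; index)
open import Data.List.Relation.Unary.Any.Properties using (lookup-index)
open import Data.Product using (∃; ∃₂; _×_; _,_; proj₁; proj₂)
open import Data.Sum using (_⊎_; inj₁; inj₂)
open import Data.Empty using (⊥-elim)
open import Function using (_∘_; _$_)
open import Function.Definitions using (Injective)
open import Relation.Binary.Definitions using (DecidableEquality; tri<; tri≈; tri>)
open import Relation.Binary.PropositionalEquality
open import Relation.Nullary using (¬?; yes; no; contradiction)
open import Relation.Nullary.Decidable using (map′)

m<n⇒∃[o]n≡1+o+m : ∀ {m n} → m < n → ∃ λ o → n ≡ suc (o + m)
m<n⇒∃[o]n≡1+o+m {m} m<n with o , refl ← m≤n⇒∃[o]m+o≡n m<n = o , cong suc (+-comm m o)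

[m+o]∸[n+o]≡m∸n : ∀ m n o → (m + o) ∸ (n + o) ≡ m ∸ n
[m+o]∸[n+o]≡m∸n m n o = trans (cong₂ _∸_ (+-comm m o) (+-comm n o)) ([m+n]∸[m+o]≡n∸o o m n)

-- mex and nim sequences

range⊆⇒≤length : ∀ {L} (xs : List ℕ) → (∀ {w} → w < L → w ∈ xs) → L ≤ length xs
range⊆⇒≤length {L} xs range⊆ = ≮⇒≥ λ short →
  let (i , j , i<j , same) = pigeonhole short position
  in <-irrefl (trans (lookup-index (range⊆ (toℕ<n i)))
                (trans (cong (lookup xs) same) (sym (lookup-index (range⊆ (toℕ<n j)))))) i<j
  where
  position : Fin L → Fin (length xs)
  position i = index (range⊆ (toℕ<n i))

mexFrom-below : ∀ fuel k xs {w} → k ≤ w → w < mexFrom fuel k xs → w ∈ xs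
mexFrom-below zero k xs k≤w w< = contradiction w< (≤⇒≯ k≤w)
mexFrom-below (suc fuel) k xs {w} k≤w w< with k ∈? xs
... | no _ = contradiction w< (≤⇒≯ k≤w)
... | yes k∈ with k ≟ w
...   | yes refl = k∈
...   | no k≢w = mexFrom-below fuel (suc k) xs (≤∧≢⇒< k≤w k≢w) w<

mexFrom-∉-or-exhausted : ∀ fuel k xs → mexFrom fuel k xs ∉ xs ⊎ mexFrom fuel k xs ≡ fuel + k
mexFrom-∉-or-exhausted zero k xs = inj₂ refl
mexFrom-∉-or-exhausted (suc fuel) k xs with k ∈? xs
... | no k∉ = inj₁ k∉
... | yes _ with mexFrom-∉-or-exhausted fuel (suc k) xs
...   | inj₁ notIn = inj₁ notIn
...   | inj₂ eq = inj₂ (trans eq (+-suc fuel k))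

mex-minimal : ∀ xs {w} → w < mex xs → w ∈ xs
mex-minimal xs = mexFrom-below (suc (length xs)) 0 xs z≤n

-- The fuel length + 1 cannot run out: that would put length + 1 distinct numbers in xs.
mex-∉ : ∀ xs → mex xs ∉ xs
mex-∉ xs with mexFrom-∉-or-exhausted (suc (length xs)) 0 xs
... | inj₁ notIn = notIn
... | inj₂ exhausted = contradiction (range⊆⇒≤length xs below) (<⇒≱ ≤-refl)
  where
  below : ∀ {w} → w < suc (length xs) → w ∈ xs
  below w< = mex-minimal xs (subst (_ <_) (sym (trans exhausted (+-identityʳ _))) w<)

∈-oneTo⁺ : ∀ {n s} → 1 ≤ s → s ≤ n → s ∈ oneTo n
∈-oneTo⁺ {zero} 1≤s s≤0 = contradiction (≤-trans 1≤s s≤0) λ ()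
∈-oneTo⁺ {suc n} {s} 1≤s s≤1+n with s ≟ suc n
... | yes refl = ∈-++⁺ʳ (oneTo n) (here refl)
... | no s≢1+n = ∈-++⁺ˡ (∈-oneTo⁺ 1≤s (s≤s⁻¹ (≤∧≢⇒< s≤1+n s≢1+n)))

∈-oneTo⁻ : ∀ {n s} → s ∈ oneTo n → 1 ≤ s × s ≤ n
∈-oneTo⁻ {suc n} s∈ with ∈-++⁻ (oneTo n) s∈
... | inj₁ s∈′ = let (1≤s , s≤n) = ∈-oneTo⁻ s∈′ in 1≤s , m≤n⇒m≤1+n s≤n
... | inj₂ (here refl) = s≤s z≤n , ≤-refl

module _ (X : List ℕ) where

  length-table : ∀ n → length (table X n) ≡ n
  length-table zero = refl
  length-table (suc n) = cong suc (length-table n)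

  nth-table : ∀ e k → nth (table X (suc (e + k))) e ≡ G X k
  nth-table zero k = refl
  nth-table (suc e) k = nth-table e k

  private
    option : ℕ → ℕ → ℕ
    option n s = nth (table X n) (s ∸ 1)

  options⁺ : ∀ {n k} → k < n → n ∸ k ∉ X → G X k ∈ options X (table X n)
  options⁺ {n} {k} k<n n∸k∉X with o , refl ← m<n⇒∃[o]n≡1+o+m k<n =
    subst (_∈ options X (table X n)) (nth-table o k)
      (subst (λ s → option n s ∈ options X (table X n)) size
        (∈-map⁺ (option n) (∈-filter⁺ (λ s → ¬? (s ∈? X)) in-range n∸k∉X)))
    where
    size : n ∸ k ≡ suc o
    size = m+n∸n≡m (suc o) k
    in-range : n ∸ k ∈ oneTo (length (table X n))
    in-range = subst (λ L → n ∸ k ∈ oneTo L) (sym (length-table n))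
                 (∈-oneTo⁺ (subst (1 ≤_) (sym size) (s≤s z≤n)) (m∸n≤m n k))

  options⁻ : ∀ {n w} → w ∈ options X (table X n) → ∃ λ k → k < n × n ∸ k ∉ X × G X k ≡ w
  options⁻ {n} w∈ with ∈-map⁻ (option n) w∈
  ... | s , s∈allowed , refl with ∈-filter⁻ (λ s → ¬? (s ∈? X)) s∈allowed
  ... | s∈oneTo , s∉X =
    move-of-size s (∈-oneTo⁻ (subst (λ L → s ∈ oneTo L) (length-table n) s∈oneTo)) s∉X
    where
    move-of-size : ∀ s → 1 ≤ s × s ≤ n → s ∉ X → ∃ λ k → k < n × n ∸ k ∉ X × G X k ≡ option n s
    move-of-size (suc e) (_ , s≤n) s∉X with k , refl ← m≤n⇒∃[o]m+o≡n s≤n =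
      k , s≤s (m≤n+m k e) , subst (_∉ X) (sym (m+n∸n≡m (suc e) k)) s∉X , sym (nth-table e k)

record IsNimSequence (X : List ℕ) (f : ℕ → ℕ) : Set where
  field
    no-move-between-equal : ∀ {n k} → k < n → n ∸ k ∉ X → f k ≢ f n
    move-to-each-smaller  : ∀ {n v} → v < f n → ∃ λ k → k < n × n ∸ k ∉ X × f k ≡ v

G-isNimSequence : ∀ X → IsNimSequence X (G X)
G-isNimSequence X = record
  { no-move-between-equal = λ {n} k<n n∸k∉X Gk≡Gn →
      mex-∉ (options X (table X n)) (subst (_∈ _) Gk≡Gn (options⁺ X k<n n∸k∉X))
  ; move-to-each-smaller = λ v< → options⁻ X (mex-minimal _ v<)
  }

isNimSequence⇒≗G : ∀ {X f} → IsNimSequence X f → ∀ n → f n ≡ G X n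
isNimSequence⇒≗G {X} {f} f-nim = <-rec (λ n → f n ≡ G X n) step
  where
  open IsNimSequence
  G-nim : IsNimSequence X (G X)
  G-nim = G-isNimSequence X
  step : ∀ n → (∀ {k} → k < n → f k ≡ G X k) → f n ≡ G X n
  step n ih with <-cmp (f n) (G X n)
  ... | tri≈ _ fn≡Gn _ = fn≡Gn
  ... | tri< fn<Gn _ _ =
    let (k , k<n , n∸k∉X , Gk≡fn) = move-to-each-smaller G-nim fn<Gn
    in contradiction (trans (ih k<n) Gk≡fn) (no-move-between-equal f-nim k<n n∸k∉X)
  ... | tri> _ _ Gn<fn =
    let (k , k<n , n∸k∉X , fk≡Gn) = move-to-each-smaller f-nim Gn<fn
    in contradiction (trans (sym (ih k<n)) fk≡Gn) (no-move-between-equal G-nim k<n n∸k∉X)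

G-cong : ∀ {X Y} → X ⊆ Y → Y ⊆ X → ∀ n → G Y n ≡ G X n
G-cong {X} {Y} X⊆Y Y⊆X = isNimSequence⇒≗G record
  { no-move-between-equal = λ k<n n∸k∉X → no-move-between-equal k<n (n∸k∉X ∘ Y⊆X)
  ; move-to-each-smaller = λ v< →
      let (k , k<n , n∸k∉Y , Gk≡v) = move-to-each-smaller v< in k , k<n , n∸k∉Y ∘ X⊆Y , Gk≡v
  }
  where open IsNimSequence (G-isNimSequence Y)

ArithmeticallyPeriodic : (ℕ → ℕ) → Set
ArithmeticallyPeriodic f = ∃₂ λ (p s : ℕ) → 1 ≤ p × ((n : ℕ) → f (n + p) ≡ f n + s)

arithmeticallyPeriodic-resp : ∀ {f g} → (∀ n → f n ≡ g n) → ArithmeticallyPeriodic f → ArithmeticallyPeriodic g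
arithmeticallyPeriodic-resp {f} {g} f≗g (p , s , 1≤p , shift) = p , s , 1≤p , λ n → begin
  g (n + p) ≡⟨ f≗g (n + p) ⟨
  f (n + p) ≡⟨ shift n ⟩
  f n + s   ≡⟨ cong (_+ s) (f≗g n) ⟩
  g n + s   ∎
  where open ≡-Reasoning

-- Periodicity of two-sided recurrences

module TwoSidedRecurrence {A : Set} {r : ℕ} {toFin : A → Fin r} (toFin-injective : Injective _≡_ _≡_ toFin)
                          (m : ℕ) (f : ℕ → A) where

  SameWindow : ℕ → ℕ → Set
  SameWindow n n' = ∀ i → i < m → f (i + n) ≡ f (i + n')

  sameWindow-repeats : ∃₂ λ n n' → n < n' × SameWindow n n'
  sameWindow-repeats =
    let (i , j , i<j , same-code) = pigeonhole (n<1+n (r ^ m)) (code ∘ toℕ)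
    in toℕ i , toℕ j , i<j , λ k k<m → toFin-injective (begin
      toFin (f (k + toℕ i))                  ≡⟨ cong (λ k → toFin (f (k + toℕ i))) (toℕ-fromℕ< k<m) ⟨
      window (toℕ i) (fromℕ< k<m)             ≡⟨ finToFun-funToFin (window (toℕ i)) (fromℕ< k<m) ⟨
      finToFun (code (toℕ i)) (fromℕ< k<m)    ≡⟨ cong (λ c → finToFun c (fromℕ< k<m)) same-code ⟩
      finToFun (code (toℕ j)) (fromℕ< k<m)    ≡⟨ finToFun-funToFin (window (toℕ j)) (fromℕ< k<m) ⟩
      window (toℕ j) (fromℕ< k<m)             ≡⟨ cong (λ k → toFin (f (k + toℕ j))) (toℕ-fromℕ< k<m) ⟩
      toFin (f (k + toℕ j))                  ∎)
    where
    open ≡-Reasoning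
    window : ℕ → Fin m → Fin r
    window n i = toFin (f (toℕ i + n))
    code : ℕ → Fin (r ^ m)
    code n = funToFin (window n)

  module _ (forward : ∀ {n n'} → SameWindow n n' → f (m + n) ≡ f (m + n'))
           (backward : ∀ {n n'} → SameWindow (suc n) (suc n') → f n ≡ f n') where

    sameWindow-suc : ∀ {n n'} → SameWindow n n' → SameWindow (suc n) (suc n')
    sameWindow-suc {n} {n'} same i i<m with m≤n⇒m<n∨m≡n i<m
    ... | inj₁ 1+i<m = subst₂ (λ x y → f x ≡ f y) (sym (+-suc i n)) (sym (+-suc i n')) (same (suc i) 1+i<m)
    ... | inj₂ refl = subst₂ (λ x y → f x ≡ f y) (sym (+-suc i n)) (sym (+-suc i n')) (forward same)

    sameWindow-pred : ∀ {n n'} → SameWindow (suc n) (suc n') → SameWindow n n'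
    sameWindow-pred same zero _ = backward same
    sameWindow-pred {n} {n'} same (suc i) 1+i<m =
      subst₂ (λ x y → f x ≡ f y) (+-suc i n) (+-suc i n') (same i (<-trans (n<1+n i) 1+i<m))

    sameWindow-+ : ∀ k {n n'} → SameWindow n n' → SameWindow (k + n) (k + n')
    sameWindow-+ zero same = same
    sameWindow-+ (suc k) same = sameWindow-suc (sameWindow-+ k same)

    sameWindow-∸ : ∀ k {n n'} → SameWindow (k + n) (k + n') → SameWindow n n'
    sameWindow-∸ zero same = same
    sameWindow-∸ (suc k) same = sameWindow-∸ k (sameWindow-pred same)

    periodic : 0 < m → ∃ λ p → 0 < p × ∀ n → f (p + n) ≡ f n
    periodic 0<m with n , _ , n<n' , same ← sameWindow-repeats
                 with o , refl ← m<n⇒∃[o]n≡1+o+m n<n' = suc o , s≤s z≤n , λ k →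
      let same-from-0 = sameWindow-∸ n (subst₂ SameWindow (sym (+-identityʳ n)) (+-comm (suc o) n) same)
      in sym (subst₂ (λ x y → f x ≡ f y) (+-identityʳ k) (+-comm k (suc o))
                (sameWindow-+ k same-from-0 0 0<m))

-- The excluded set {a, 2a, 3a}

divMod-unique : ∀ {d r₁ r₂ q₁ q₂} .{{_ : NonZero d}} → r₁ < d → r₂ < d →
                r₁ + q₁ * d ≡ r₂ + q₂ * d → r₁ ≡ r₂ × q₁ ≡ q₂
divMod-unique {d} {r₁} {r₂} {q₁} {q₂} r₁<d r₂<d eq =
  r₁≡r₂ , *-cancelʳ-≡ q₁ q₂ d (+-cancelˡ-≡ r₂ _ _ (trans (cong (_+ q₁ * d) (sym r₁≡r₂)) eq))
  where
  open ≡-Reasoning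
  r₁≡r₂ : r₁ ≡ r₂
  r₁≡r₂ = begin
    r₁                 ≡⟨ m<n⇒m%n≡m r₁<d ⟨
    r₁ % d             ≡⟨ [m+kn]%n≡m%n r₁ q₁ d ⟨
    (r₁ + q₁ * d) % d  ≡⟨ cong (_% d) eq ⟩
    (r₂ + q₂ * d) % d  ≡⟨ [m+kn]%n≡m%n r₂ q₂ d ⟩
    r₂ % d             ≡⟨ m<n⇒m%n≡m r₂<d ⟩
    r₂                 ∎

%-/-unique : ∀ {d n r q} .{{_ : NonZero d}} → r < d → n ≡ r + q * d → n % d ≡ r × n / d ≡ q
%-/-unique {d} {n} r<d n≡ = divMod-unique (m%n<n n d) r<d (trans (sym (m≡m%n+[m/n]*n n d)) n≡)

module Multiples (a : ℕ) .{{_ : NonZero a}} where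

  X : List ℕ
  X = a ∷ a + a ∷ a + (a + a) ∷ []

  value : ℕ → ℕ
  value n = n % a + n / a / 4 * a

  record Digits (n w u q : ℕ) : Set where
    constructor mkDigits
    field
      w<a : w < a
      u<4 : u < 4
      expansion : n ≡ w + (u + q * 4) * a

  digits : ∀ n → Digits n (n % a) (n / a % 4) (n / a / 4)
  digits n = mkDigits (m%n<n n a) (m%n<n (n / a) 4) $
    trans (m≡m%n+[m/n]*n n a) (cong (λ j → n % a + j * a) (m≡m%n+[m/n]*n (n / a) 4))

  value-digits : ∀ {n w u q} → Digits n w u q → value n ≡ w + q * a
  value-digits {n} {w} {u} {q} (mkDigits w<a u<4 n≡) =
    let (n%a≡w , n/a≡) = %-/-unique {q = u + q * 4} w<a n≡
        (_ , n/a/4≡q) = %-/-unique {q = q} u<4 n/a≡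
    in cong₂ (λ r j → r + j * a) n%a≡w n/a/4≡q

  multiple∈X : ∀ {j} → 1 ≤ j → j < 4 → j * a ∈ X
  multiple∈X {1} _ _ = here (+-identityʳ a)
  multiple∈X {2} _ _ = there (here (cong (a +_) (+-identityʳ a)))
  multiple∈X {3} _ _ = there (there (here (cong (λ x → a + (a + x)) (+-identityʳ a))))
  multiple∈X {suc (suc (suc (suc _)))} _ (s≤s (s≤s (s≤s (s≤s ()))))

  ∈X⇒bounded : ∀ {d} → d ∈ X → a ≤ d × d ≤ a + (a + a)
  ∈X⇒bounded (here refl) = ≤-refl , m≤m+n a (a + a)
  ∈X⇒bounded (there (here refl)) = m≤m+n a a , +-monoʳ-≤ a (m≤n+m a a)
  ∈X⇒bounded (there (there (here refl))) = m≤m+n a (a + a) , ≤-refl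

  digits-<⇒middle-< : ∀ {k n w uk un q} → Digits k w uk q → Digits n w un q → k < n → uk < un
  digits-<⇒middle-< {w = w} {q = q} (mkDigits _ _ k≡) (mkDigits _ _ n≡) k<n = ≰⇒> λ un≤uk →
    <⇒≱ k<n (subst₂ _≤_ (sym n≡) (sym k≡) (+-monoʳ-≤ w (*-monoˡ-≤ a (+-monoˡ-≤ (q * 4) un≤uk))))

  digits-difference∈X : ∀ {k n w uk un q} → Digits k w uk q → Digits n w un q → k < n → n ∸ k ∈ X
  digits-difference∈X {k} {n} {w} {uk} {un} {q} dk@(mkDigits _ _ k≡) dn@(mkDigits _ un<4 n≡) k<n
    with j , refl ← m<n⇒∃[o]n≡1+o+m (digits-<⇒middle-< dk dn k<n) =
    subst (_∈ X) (sym n∸k≡) (multiple∈X (s≤s z≤n) (≤-<-trans (s≤s (m≤m+n j uk)) un<4))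
    where
    shift : ∀ w j uk q a → w + (suc (j + uk) + q * 4) * a ≡ (w + (uk + q * 4) * a) + suc j * a
    shift = solve-∀
    n∸k≡ : n ∸ k ≡ suc j * a
    n∸k≡ = trans (cong (_∸ k) (trans n≡ (trans (shift w j uk q a) (cong (_+ suc j * a) (sym k≡)))))
                 (m+n∸m≡n k (suc j * a))

  value-distinct : ∀ {n k} → k < n → n ∸ k ∉ X → value k ≢ value n
  value-distinct {n} {k} k<n n∸k∉X vk≡vn =
    let (w≡ , q≡) = divMod-unique (m%n<n k a) (m%n<n n a)
                      (trans (sym (value-digits (digits k))) (trans vk≡vn (value-digits (digits n))))
    in n∸k∉X (digits-difference∈X (subst₂ (λ w q → Digits k w (k / a % 4) q) w≡ q≡ (digits k)) (digits n) k<n)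

  reach-earlier-block : ∀ {n v} → v / a < n / a / 4 → ∃ λ k → k < n × n ∸ k ∉ X × value k ≡ v
  reach-earlier-block {n} {v} qv<qn = k , ≤-<-trans (m≤m+n k _) far , far-from-X , value-k
    where
    k : ℕ
    k = v % a + (0 + v / a * 4) * a
    value-k : value k ≡ v
    value-k = trans (value-digits (mkDigits {q = v / a} (m%n<n v a) (s≤s z≤n) refl)) (sym (m≡m%n+[m/n]*n v a))
    block : ∀ q a → a + (0 + q * 4) * a + (a + (a + a)) ≡ (0 + suc q * 4) * a
    block = solve-∀
    far : k + (a + (a + a)) < n
    far = begin-strict
      k + (a + (a + a))                        <⟨ +-monoˡ-< _ (+-monoˡ-< _ (m%n<n v a)) ⟩
      a + (0 + v / a * 4) * a + (a + (a + a))  ≡⟨ block (v / a) a ⟩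
      (0 + suc (v / a) * 4) * a               ≤⟨ *-monoˡ-≤ a (≤-trans (*-monoˡ-≤ 4 qv<qn) (m≤n+m _ (n / a % 4))) ⟩
      (n / a % 4 + n / a / 4 * 4) * a         ≤⟨ m≤n+m _ (n % a) ⟩
      n % a + (n / a % 4 + n / a / 4 * 4) * a ≡⟨ Digits.expansion (digits n) ⟨
      n                                        ∎
      where open ≤-Reasoning
    far-from-X : n ∸ k ∉ X
    far-from-X n∸k∈X = <⇒≱ far (begin
      n                 ≡⟨ m+[n∸m]≡n (≤-trans (m≤m+n k _) (<⇒≤ far)) ⟨
      k + (n ∸ k)       ≤⟨ +-monoʳ-≤ k (proj₂ (∈X⇒bounded n∸k∈X)) ⟩
      k + (a + (a + a)) ∎)
      where open ≤-Reasoning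

  reach-same-block : ∀ {n v} → v / a ≡ n / a / 4 → v < value n →
                     ∃ λ k → k < n × n ∸ k ∉ X × value k ≡ v
  reach-same-block {n} {v} qv≡qn v<vn = k , k<n , near-not-X , value-k
    where
    R k : ℕ
    R = (n / a % 4 + n / a / 4 * 4) * a
    k = v % a + R
    v≡ : v ≡ v % a + n / a / 4 * a
    v≡ = trans (m≡m%n+[m/n]*n v a) (cong (λ q → v % a + q * a) qv≡qn)
    wv<wn : v % a < n % a
    wv<wn = +-cancelʳ-< _ _ _ (subst₂ _<_ v≡ (value-digits (digits n)) v<vn)
    value-k : value k ≡ v
    value-k = trans (value-digits (mkDigits {q = n / a / 4} (m%n<n v a) (m%n<n (n / a) 4) refl)) (sym v≡)
    k<n : k < n
    k<n = subst (k <_) (sym (Digits.expansion (digits n))) (+-monoˡ-< R wv<wn)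
    near-not-X : n ∸ k ∉ X
    near-not-X n∸k∈X = <⇒≱ (m%n<n n a) (begin
      a                 ≤⟨ proj₁ (∈X⇒bounded n∸k∈X) ⟩
      n ∸ k             ≡⟨ cong (_∸ k) (Digits.expansion (digits n)) ⟩
      (n % a + R) ∸ k   ≡⟨ [m+o]∸[n+o]≡m∸n (n % a) (v % a) R ⟩
      n % a ∸ v % a     ≤⟨ m∸n≤m (n % a) (v % a) ⟩
      n % a             ∎)
      where open ≤-Reasoning

  value-complete : ∀ {n v} → v < value n → ∃ λ k → k < n × n ∸ k ∉ X × value k ≡ v
  value-complete {n} {v} v<vn with <-cmp (v / a) (n / a / 4)
  ... | tri< qv<qn _ _ = reach-earlier-block qv<qn
  ... | tri≈ _ qv≡qn _ = reach-same-block qv≡qn v<vn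
  ... | tri> _ _ qn<qv = contradiction v<vn (≤⇒≯ (begin
    value n               ≡⟨ value-digits (digits n) ⟩
    n % a + n / a / 4 * a ≤⟨ +-monoˡ-≤ _ (<⇒≤ (m%n<n n a)) ⟩
    suc (n / a / 4) * a   ≤⟨ *-monoˡ-≤ a qn<qv ⟩
    v / a * a             ≤⟨ m≤n+m _ (v % a) ⟩
    v % a + v / a * a     ≡⟨ m≡m%n+[m/n]*n v a ⟨
    v                     ∎))
    where open ≤-Reasoning

  value≗G : ∀ n → value n ≡ G X n
  value≗G = isNimSequence⇒≗G record
    { no-move-between-equal = value-distinct ; move-to-each-smaller = value-complete }

  value-shift : ∀ n → value (n + 4 * a) ≡ value n + a
  value-shift n = begin
    value (n + 4 * a)           ≡⟨ value-digits next-digits ⟩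
    n % a + suc (n / a / 4) * a ≡⟨ step (n % a) (n / a / 4) a ⟩
    n % a + n / a / 4 * a + a   ≡⟨ cong (_+ a) (value-digits (digits n)) ⟨
    value n + a                 ∎
    where
    open ≡-Reasoning
    next-block : ∀ w u q a → w + (u + q * 4) * a + 4 * a ≡ w + (u + suc q * 4) * a
    next-block = solve-∀
    step : ∀ w q a → w + suc q * a ≡ w + q * a + a
    step = solve-∀
    next-digits : Digits (n + 4 * a) (n % a) (n / a % 4) (suc (n / a / 4))
    next-digits = mkDigits (m%n<n n a) (m%n<n (n / a) 4) $
      trans (cong (_+ 4 * a) (Digits.expansion (digits n))) (next-block (n % a) (n / a % 4) (n / a / 4) a)

  G-arithmeticallyPeriodic : ArithmeticallyPeriodic (G X)
  G-arithmeticallyPeriodic = arithmeticallyPeriodic-resp value≗G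
    (4 * a , a , ≤-trans (>-nonZero⁻¹ a) (m≤n*m a 4) , value-shift)

-- The excluded set {a, a + c, 2a + c} with c ≠ a

-- S opens a triple at a heap i, A or B is its second heap i + a or i + b, and C closes it at i + a + b.
data Label : Set where
  S A B C : Label

toFin : Label → Fin 4
toFin S = zero
toFin A = suc zero
toFin B = suc (suc zero)
toFin C = suc (suc (suc zero))

fromFin : Fin 4 → Label
fromFin zero = S
fromFin (suc zero) = A
fromFin (suc (suc zero)) = B
fromFin (suc (suc (suc zero))) = C

fromFin-toFin : ∀ l → fromFin (toFin l) ≡ l
fromFin-toFin S = refl
fromFin-toFin A = refl
fromFin-toFin B = refl
fromFin-toFin C = refl

toFin-injective : Injective _≡_ _≡_ toFin
toFin-injective {x} {y} eq = trans (sym (fromFin-toFin x)) (trans (cong fromFin eq) (fromFin-toFin y))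

_≟ᴸ_ : DecidableEquality Label
x ≟ᴸ y = map′ toFin-injective (cong toFin) (toFin x ≟ᶠ toFin y)

-- The label of heap n from those of the heaps n − (a + b), n − b, n − c and n − a.
rule : Label → Label → Label → Label → Label
rule x y u z with x ≟ᴸ S | y ≟ᴸ S | u ≟ᴸ A | z ≟ᴸ S
... | yes _ | _     | _    | _     = C
... | no _  | yes _ | no _ | _     = B
... | no _  | _     | _    | yes _ = A
... | no _  | _     | _    | no _  = S

data Rule (x y u z : Label) : Label → Set where
  ruleC : x ≡ S → Rule x y u z C
  ruleB  : x ≢ S → y ≡ S → u ≢ A → Rule x y u z B
  ruleA  : x ≢ S → (y ≡ S → u ≡ A) → z ≡ S → Rule x y u z A
  ruleS : x ≢ S → (y ≡ S → u ≡ A) → z ≢ S → Rule x y u z S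

rule-sound : ∀ x y u z → Rule x y u z (rule x y u z)
rule-sound x y u z with x ≟ᴸ S | y ≟ᴸ S | u ≟ᴸ A | z ≟ᴸ S
... | yes x≡S | _       | _       | _       = ruleC x≡S
... | no x≢S  | yes y≡S | no u≢A  | _       = ruleB x≢S y≡S u≢A
... | no x≢S  | yes _   | yes u≡A | yes z≡S = ruleA x≢S (λ _ → u≡A) z≡S
... | no x≢S  | yes _   | yes u≡A | no z≢S  = ruleS x≢S (λ _ → u≡A) z≢S
... | no x≢S  | no y≢S  | _       | yes z≡S = ruleA x≢S (⊥-elim ∘ y≢S) z≡S
... | no x≢S  | no y≢S  | _       | no z≢S  = ruleS x≢S (⊥-elim ∘ y≢S) z≢S

rule-cong : ∀ {x x′ y y′ u u′ z z′} → x ≡ x′ → y ≡ y′ → u ≡ u′ → z ≡ z′ →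
            rule x y u z ≡ rule x′ y′ u′ z′
rule-cong refl refl refl refl = refl

-- The label of heap j from those of the heaps j + a + b, j + b, j + c and j + a.
data Recovers (x y u z : Label) : Label → Set where
  fromS : x ≡ C → Recovers x y u z S
  fromA : x ≢ C → y ≡ C → u ≢ B → Recovers x y u z A
  fromB : x ≢ C → (y ≡ C → u ≡ B) → z ≡ C → Recovers x y u z B
  fromC : x ≢ C → (y ≡ C → u ≡ B) → z ≢ C → Recovers x y u z C

recovers-resp : ∀ {x x′ y y′ u u′ z z′ l} → x ≡ x′ → y ≡ y′ → u ≡ u′ → z ≡ z′ →
                Recovers x y u z l → Recovers x′ y′ u′ z′ l
recovers-resp refl refl refl refl r = r

recovers-unique : ∀ {x y u z l l′} → Recovers x y u z l → Recovers x y u z l′ → l ≡ l′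
recovers-unique (fromS _)        (fromS _)        = refl
recovers-unique (fromA _ _ _)    (fromA _ _ _)    = refl
recovers-unique (fromB _ _ _)    (fromB _ _ _)    = refl
recovers-unique (fromC _ _ _)    (fromC _ _ _)    = refl
recovers-unique (fromS x≡C)      (fromA x≢C _ _)  = contradiction x≡C x≢C
recovers-unique (fromS x≡C)      (fromB x≢C _ _)  = contradiction x≡C x≢C
recovers-unique (fromS x≡C)      (fromC x≢C _ _)  = contradiction x≡C x≢C
recovers-unique (fromA x≢C _ _)  (fromS x≡C)      = contradiction x≡C x≢C
recovers-unique (fromB x≢C _ _)  (fromS x≡C)      = contradiction x≡C x≢C
recovers-unique (fromC x≢C _ _)  (fromS x≡C)      = contradiction x≡C x≢C
recovers-unique (fromA _ y≡C u≢B) (fromB _ y⇒u _) = contradiction (y⇒u y≡C) u≢B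
recovers-unique (fromA _ y≡C u≢B) (fromC _ y⇒u _) = contradiction (y⇒u y≡C) u≢B
recovers-unique (fromB _ y⇒u _) (fromA _ y≡C u≢B) = contradiction (y⇒u y≡C) u≢B
recovers-unique (fromC _ y⇒u _) (fromA _ y≡C u≢B) = contradiction (y⇒u y≡C) u≢B
recovers-unique (fromB _ _ z≡C)  (fromC _ _ z≢C)  = contradiction z≡C z≢C
recovers-unique (fromC _ _ z≢C)  (fromB _ _ z≡C)  = contradiction z≡C z≢C

rule-C : ∀ {x y u z} → Rule x y u z C → x ≡ S
rule-C (ruleC x≡S) = x≡S

rule-B : ∀ {x y u z} → Rule x y u z B → y ≡ S
rule-B (ruleB _ y≡S _) = y≡S

rule-A : ∀ {x y u z} → Rule x y u z A → z ≡ S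
rule-A (ruleA _ _ z≡S) = z≡S

rule-x≡S : ∀ {x y u z l} → x ≡ S → Rule x y u z l → l ≡ C
rule-x≡S _   (ruleC _)       = refl
rule-x≡S x≡S (ruleB x≢S _ _) = contradiction x≡S x≢S
rule-x≡S x≡S (ruleA x≢S _ _) = contradiction x≡S x≢S
rule-x≡S x≡S (ruleS x≢S _ _) = contradiction x≡S x≢S

rule-y≡S : ∀ {x y u z l} → y ≡ S → Rule x y u z l → l ≡ C ⊎ l ≡ B ⊎ u ≡ A
rule-y≡S _   (ruleC _)         = inj₁ refl
rule-y≡S _   (ruleB _ _ _)     = inj₂ (inj₁ refl)
rule-y≡S y≡S (ruleA _ y⇒u _)   = inj₂ (inj₂ (y⇒u y≡S))
rule-y≡S y≡S (ruleS _ y⇒u _)   = inj₂ (inj₂ (y⇒u y≡S))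

rule-u≡A : ∀ {x y u z l} → u ≡ A → Rule x y u z l → l ≢ B
rule-u≡A u≡A (ruleB _ _ u≢A) refl = u≢A u≡A

rule-z≡S : ∀ {x y u z l} → z ≡ S → Rule x y u z l → l ≢ S
rule-z≡S z≡S (ruleS _ _ z≢S) refl = z≢S z≡S

-- Histories list the most recent label first. Reading before position 0, or at the meaningless
-- d = 0, gives C, which never opens a triple.
_‼_ : List Label → ℕ → Label
[]       ‼ _           = C
(l ∷ ls) ‼ zero        = C
(l ∷ ls) ‼ suc zero    = l
(l ∷ ls) ‼ suc (suc d) = ls ‼ suc d

module Labelling (a′ c′ : ℕ) where

  a c b m : ℕ
  a = suc a′
  c = suc c′
  b = a + c
  m = a + b

  opaque
    label : ℕ → Label
    history : ℕ → List Label

    label n = rule (history n ‼ m) (history n ‼ b) (history n ‼ c) (history n ‼ a)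

    history zero = []
    history (suc n) = label n ∷ history n

    history-‼ : ∀ e i → history (suc e + i) ‼ suc e ≡ label i
    history-‼ zero i = refl
    history-‼ (suc e) i = history-‼ e i

    history-‼-S : ∀ n d → history n ‼ d ≡ S → ∃ λ i → n ≡ d + i × label i ≡ S
    history-‼-S zero d ()
    history-‼-S (suc n) zero ()
    history-‼-S (suc n) (suc zero) lab = n , refl , lab
    history-‼-S (suc n) (suc (suc d)) lab =
      let (i , n≡ , lab-i) = history-‼-S n (suc d) lab in i , cong suc n≡ , lab-i

    label-unfold : ∀ n → label n ≡ rule (history n ‼ m) (history n ‼ b) (history n ‼ c) (history n ‼ a)
    label-unfold n = refl

  label-rule : ∀ n → Rule (history n ‼ m) (history n ‼ b) (history n ‼ c) (history n ‼ a) (label n)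
  label-rule n = subst (Rule _ _ _ _) (sym (label-unfold n)) (rule-sound _ _ _ _)

  history-‼-≡ : ∀ e {n} i → n ≡ suc e + i → history n ‼ suc e ≡ label i
  history-‼-≡ e i refl = history-‼ e i

  S⇒C-at-m : ∀ {i} → label i ≡ S → label (m + i) ≡ C
  S⇒C-at-m {i} lab = rule-x≡S (trans (history-‼ (a′ + b) i) lab) (label-rule (m + i))

  C-origin : ∀ {n} → label n ≡ C → ∃ λ i → n ≡ m + i × label i ≡ S
  C-origin {n} lab = history-‼-S n m (rule-C (subst (Rule _ _ _ _) lab (label-rule n)))

  B-origin : ∀ {n} → label n ≡ B → ∃ λ i → n ≡ b + i × label i ≡ S
  B-origin {n} lab = history-‼-S n b (rule-B (subst (Rule _ _ _ _) lab (label-rule n)))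

  A-origin : ∀ {n} → label n ≡ A → ∃ λ i → n ≡ a + i × label i ≡ S
  A-origin {n} lab = history-‼-S n a (rule-A (subst (Rule _ _ _ _) lab (label-rule n)))

  S⇒¬S-at-a : ∀ {i} → label i ≡ S → label (a + i) ≢ S
  S⇒¬S-at-a {i} lab = rule-z≡S (trans (history-‼ a′ i) lab) (label-rule (a + i))

  A-at-a⇒¬B-at-b : ∀ {i} → label (a + i) ≡ A → label (b + i) ≢ B
  A-at-a⇒¬B-at-b {i} lab = rule-u≡A (trans (history-‼-≡ c′ (a + i) (xy∙z≈y∙xz a c i)) lab) (label-rule (b + i))

  S⇒A-at-a⊎B-at-b : ∀ {i} → label i ≡ S → label (a + i) ≡ A ⊎ label (b + i) ≡ B
  S⇒A-at-a⊎B-at-b {i} lab with rule-y≡S (trans (history-‼ (a′ + c) i) lab) (label-rule (b + i))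
  ... | inj₂ (inj₁ B-at-b) = inj₂ B-at-b
  ... | inj₂ (inj₂ A-at-a) = inj₁ (trans (sym (history-‼-≡ c′ (a + i) (xy∙z≈y∙xz a c i))) A-at-a)
  ... | inj₁ C-at-b with C-origin C-at-b
  ...   | i′ , b+i≡m+i′ , lab′ = contradiction (subst (λ j → label j ≡ S) i≡a+i′ lab) (S⇒¬S-at-a lab′)
    where
    i≡a+i′ : i ≡ a + i′
    i≡a+i′ = +-cancelˡ-≡ b i (a + i′) (trans b+i≡m+i′ (xy∙z≈y∙xz a b i′))

  C-at-m⇒S : ∀ {j} → label (m + j) ≡ C → label j ≡ S
  C-at-m⇒S {j} lab with i , m+j≡m+i , lab-i ← C-origin lab =
    subst (λ k → label k ≡ S) (sym (+-cancelˡ-≡ m j i m+j≡m+i)) lab-i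

  C-at-b⇒B-at-c : ∀ {j} → label j ≢ A → label (b + j) ≡ C → label (c + j) ≡ B
  C-at-b⇒B-at-c {j} ¬A lab with i , b+j≡m+i , lab-i ← C-origin lab
    with j≡a+i ← +-cancelˡ-≡ b j (a + i) (trans b+j≡m+i (xy∙z≈y∙xz a b i))
    with S⇒A-at-a⊎B-at-b lab-i
  ... | inj₁ A-at-a = contradiction (subst (λ k → label k ≡ A) (sym j≡a+i) A-at-a) ¬A
  ... | inj₂ B-at-b = subst (λ k → label k ≡ B) (trans (xy∙z≈y∙xz a c i) (cong (c +_) (sym j≡a+i))) B-at-b

  ¬S⇒¬C-at-m : ∀ {j l} → label j ≡ l → l ≢ S → label (m + j) ≢ C
  ¬S⇒¬C-at-m lab l≢S C-at-m = l≢S (trans (sym lab) (C-at-m⇒S C-at-m))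

  label-recovers : ∀ j → Recovers (label (m + j)) (label (b + j)) (label (c + j)) (label (a + j)) (label j)
  label-recovers j with label j in lab
  ... | S = fromS (S⇒C-at-m lab)
  ... | A with i , refl , lab-i ← A-origin {j} lab =
    fromA (¬S⇒¬C-at-m lab λ ())
          (subst (λ k → label k ≡ C) (xy∙z≈y∙xz a b i) (S⇒C-at-m lab-i))
          (A-at-a⇒¬B-at-b lab ∘ subst (λ k → label k ≡ B) (sym (xy∙z≈y∙xz a c i)))
  ... | B with i , refl , lab-i ← B-origin {j} lab =
    fromB (¬S⇒¬C-at-m lab λ ()) (C-at-b⇒B-at-c (λ lab′ → contradiction (trans (sym lab) lab′) λ ()))
          (subst (λ k → label k ≡ C) (+-assoc a b i) (S⇒C-at-m lab-i))
  ... | C with i , refl , lab-i ← C-origin {j} lab =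
    fromC (¬S⇒¬C-at-m lab λ ()) (C-at-b⇒B-at-c (λ lab′ → contradiction (trans (sym lab) lab′) λ ()))
          (S⇒¬S-at-a lab-i ∘ C-at-m⇒S ∘ subst (λ k → label k ≡ C) (x∙yz≈y∙xz a m i))

  label-forward : ∀ n → label (m + n) ≡ rule (label n) (label (a + n)) (label ((a + a) + n)) (label (b + n))
  label-forward n = trans (label-unfold (m + n)) $ rule-cong (history-‼ (a′ + b) n)
    (history-‼-≡ (a′ + c) (a + n) (ring₁ a c n)) (history-‼-≡ c′ ((a + a) + n) (ring₂ a c n))
    (history-‼-≡ a′ (b + n) (+-assoc a b n))
    where
    ring₁ : ∀ a c n → (a + (a + c)) + n ≡ (a + c) + (a + n)
    ring₁ = solve-∀
    ring₂ : ∀ a c n → (a + (a + c)) + n ≡ c + ((a + a) + n)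
    ring₂ = solve-∀

  a<b : a < b
  a<b = m<m+n a (s≤s z≤n)

  b<m : b < m
  b<m = m<n+m b (s≤s z≤n)

  a+a<m : a + a < m
  a+a<m = +-monoʳ-< a (m<m+n a (s≤s z≤n))

  open TwoSidedRecurrence toFin-injective m label

  label-periodic : ∃ λ p → 0 < p × ∀ n → label (p + n) ≡ label n
  label-periodic = periodic forward backward (s≤s z≤n)
    where
    forward : ∀ {n n′} → SameWindow n n′ → label (m + n) ≡ label (m + n′)
    forward {n} {n′} same = trans (label-forward n) (trans
      (rule-cong (same 0 (s≤s z≤n)) (same a (<-trans a<b b<m)) (same (a + a) a+a<m) (same b b<m))
      (sym (label-forward n′)))
    backward : ∀ {n n′} → SameWindow (suc n) (suc n′) → label n ≡ label n′
    backward {n} {n′} same = recovers-unique (label-recovers n)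
      (recovers-resp (sym (same-at (a′ + b) ≤-refl)) (sym (same-at (a′ + c) (<⇒≤ b<m)))
                       (sym (same-at c′ (<⇒≤ (<-trans (m<n+m c (s≤s z≤n)) b<m))))
                       (sym (same-at a′ (<⇒≤ (<-trans a<b b<m))))
                       (label-recovers n′))
      where
      same-at : ∀ e → suc e ≤ m → label (suc e + n) ≡ label (suc e + n′)
      same-at e 1+e≤m = subst₂ (λ x y → label x ≡ label y) (+-suc e n) (+-suc e n′) (same e 1+e≤m)

  offset : Label → ℕ
  offset S = 0
  offset A = a
  offset B = b
  offset C = m

  offset-origin : ∀ n → ∃ λ i → n ≡ offset (label n) + i × label i ≡ S
  offset-origin n with label n in lab
  ... | S = n , refl , lab
  ... | A = A-origin lab
  ... | B = B-origin lab
  ... | C = C-origin lab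

  origin : ℕ → ℕ
  origin n = n ∸ offset (label n)

  origin-of : ∀ n {i} l → label n ≡ l → n ≡ offset l + i → origin n ≡ i
  origin-of n {i} l refl n≡ = trans (cong (_∸ offset l) n≡) (m+n∸m≡n (offset l) i)

  offset+origin : ∀ n → offset (label n) + origin n ≡ n
  offset+origin n =
    let (i , n≡ , _) = offset-origin n
    in trans (cong (offset (label n) +_) (origin-of n (label n) refl n≡)) (sym n≡)

  label-origin : ∀ n → label (origin n) ≡ S
  label-origin n =
    let (i , n≡ , lab-i) = offset-origin n
    in subst (λ k → label k ≡ S) (sym (origin-of n (label n) refl n≡)) lab-i

  isS : Label → ℕ
  isS S = 1
  isS A = 0
  isS B = 0
  isS C = 0

  starts : ℕ → ℕ
  starts zero = 0
  starts (suc n) = isS (label n) + starts n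

  value : ℕ → ℕ
  value n = starts (origin n)

  starts-mono : ∀ {i j} → i ≤ j → starts i ≤ starts j
  starts-mono {j = zero} z≤n = ≤-refl
  starts-mono {i} {suc j} i≤1+j with m≤n⇒m<n∨m≡n i≤1+j
  ... | inj₁ i<1+j = ≤-trans (starts-mono (s≤s⁻¹ i<1+j)) (m≤n+m (starts j) _)
  ... | inj₂ refl = ≤-refl

  starts-strict : ∀ {i j} → label i ≡ S → i < j → starts i < starts j
  starts-strict {i} lab i<j = ≤-trans (≤-reflexive (cong (λ l → isS l + starts i) (sym lab))) (starts-mono i<j)

  starts-injective : ∀ {i j} → label i ≡ S → label j ≡ S → starts i ≡ starts j → i ≡ j
  starts-injective {i} {j} lab-i lab-j eq with <-cmp i j
  ... | tri< i<j _ _ = contradiction eq (<⇒≢ (starts-strict lab-i i<j))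
  ... | tri≈ _ i≡j _ = i≡j
  ... | tri> _ _ j<i = contradiction (sym eq) (<⇒≢ (starts-strict lab-j j<i))

  starts-reaches : ∀ {k v} → v < starts k → ∃ λ i → i < k × label i ≡ S × starts i ≡ v
  starts-reaches {suc k} {v} v< with v <? starts k
  ... | yes v<k = let (i , i<k , lab , eq) = starts-reaches v<k in i , m<n⇒m<1+n i<k , lab , eq
  ... | no v≮k with label k in lab
  ...   | S = k , ≤-refl , lab , ≤-antisym (≮⇒≥ v≮k) (s≤s⁻¹ v<)
  ...   | A = contradiction v< v≮k
  ...   | B = contradiction v< v≮k
  ...   | C = contradiction v< v≮k

  X : List ℕ
  X = a ∷ b ∷ m ∷ []

  offset-gap∈X : ∀ {i} lk ln → label (offset lk + i) ≡ lk → label (offset ln + i) ≡ ln →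
                 offset lk < offset ln → offset ln ∸ offset lk ∈ X
  offset-gap∈X S A _     _     _  = here refl
  offset-gap∈X S B _     _     _  = there (here refl)
  offset-gap∈X S C _     _     _  = there (there (here refl))
  offset-gap∈X A C _     _     _  = there (here (m+n∸m≡n a b))
  offset-gap∈X B C _     _     _  = here (m+n∸n≡m a b)
  offset-gap∈X A B lab-k lab-n _  = contradiction lab-n (A-at-a⇒¬B-at-b lab-k)
  offset-gap∈X _ S _     _     ()
  offset-gap∈X A A _     _     lt = contradiction lt (<-irrefl refl)
  offset-gap∈X B B _     _     lt = contradiction lt (<-irrefl refl)
  offset-gap∈X C C _     _     lt = contradiction lt (<-irrefl refl)
  offset-gap∈X B A _     _     lt = contradiction lt (<-asym a<b)
  offset-gap∈X C A _     _     lt = contradiction lt (<-asym (<-trans a<b b<m))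
  offset-gap∈X C B _     _     lt = contradiction lt (<-asym b<m)

  value-distinct : ∀ {n k} → k < n → n ∸ k ∉ X → value k ≢ value n
  value-distinct {n} {k} k<n n∸k∉X eq = n∸k∉X (subst (_∈ X) (sym n∸k≡) gap∈X)
    where
    i : ℕ
    i = origin n
    k≡ : k ≡ offset (label k) + i
    k≡ = trans (sym (offset+origin k))
           (cong (offset (label k) +_) (starts-injective (label-origin k) (label-origin n) eq))
    n≡ : n ≡ offset (label n) + i
    n≡ = sym (offset+origin n)
    gap∈X : offset (label n) ∸ offset (label k) ∈ X
    gap∈X = offset-gap∈X (label k) (label n) (cong label (sym k≡)) (cong label (sym n≡))
              (+-cancelʳ-< i _ _ (subst₂ _<_ k≡ n≡ k<n))
    n∸k≡ : n ∸ k ≡ offset (label n) ∸ offset (label k)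
    n∸k≡ = trans (cong₂ _∸_ n≡ k≡) ([m+o]∸[n+o]≡m∸n (offset (label n)) (offset (label k)) i)

  origin<⇒< : ∀ {n i} → i < origin n → i < n
  origin<⇒< {n} i<origin = <-≤-trans i<origin (m∸n≤m n (offset (label n)))

  offset≥a : ∀ l → l ≢ S → a ≤ offset l
  offset≥a S l≢S = contradiction refl l≢S
  offset≥a A _ = ≤-refl
  offset≥a B _ = <⇒≤ a<b
  offset≥a C _ = <⇒≤ (<-trans a<b b<m)

  -- n lies outside the triple opened at i.
  gap-below-origin : ∀ {n i d} → label i ≡ S → i < origin n → n ≡ d + i →
                     d ≢ a × d ≢ m × (d ≡ b → label (a + i) ≡ A)
  gap-below-origin {n} {i} lab-i i<origin n≡ = gap≢a , gap≢m , gap≡b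
    where
    not-origin : ∀ l → label n ≡ l → n ≢ offset l + i
    not-origin l lab n≡′ = <-irrefl (sym (origin-of n l lab n≡′)) i<origin
    gap≢a : _ ≢ a
    gap≢a refl = ≤⇒≯ (begin
      origin n     ≤⟨ ∸-monoʳ-≤ n (offset≥a (label n) (S⇒¬S-at-a {i} lab-i ∘ subst (λ k → label k ≡ S) n≡)) ⟩
      n ∸ a        ≡⟨ cong (_∸ a) n≡ ⟩
      (a + i) ∸ a  ≡⟨ m+n∸m≡n a i ⟩
      i            ∎) i<origin
      where open ≤-Reasoning
    gap≢m : _ ≢ m
    gap≢m refl = not-origin C (subst (λ k → label k ≡ C) (sym n≡) (S⇒C-at-m {i} lab-i)) n≡
    gap≡b : _ ≡ b → label (a + i) ≡ A
    gap≡b refl with S⇒A-at-a⊎B-at-b {i} lab-i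
    ... | inj₁ A-at-a = A-at-a
    ... | inj₂ B-at-b = contradiction n≡ (not-origin B (subst (λ k → label k ≡ B) (sym n≡) B-at-b))

  value-complete : a ≢ c → ∀ {n v} → v < value n → ∃ λ k → k < n × n ∸ k ∉ X × value k ≡ v
  value-complete a≢c {n} {v} v<value
    with i , i<origin , lab-i , starts-i ← starts-reaches v<value
    with gap≢a , gap≢m , gap≡b⇒A ←
           gap-below-origin {n} lab-i i<origin (sym (m∸n+n≡m (<⇒≤ (origin<⇒< i<origin))))
    with n ∸ i ≟ b
  ... | no gap≢b = i , origin<⇒< i<origin , gap∉X , trans (cong starts (origin-of i S lab-i refl)) starts-i
    where
    gap∉X : n ∸ i ∉ X
    gap∉X (here gap≡a) = gap≢a gap≡a
    gap∉X (there (here gap≡b)) = gap≢b gap≡b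
    gap∉X (there (there (here gap≡m))) = gap≢m gap≡m
  ... | yes gap≡b = a + i , a+i<n , c∉X ∘ subst (_∈ X) gap′≡c , 
      trans (cong starts (origin-of (a + i) A (gap≡b⇒A gap≡b) refl)) starts-i
    where
    n≡ : n ≡ b + i
    n≡ = trans (sym (m∸n+n≡m (<⇒≤ (origin<⇒< i<origin)))) (cong (_+ i) gap≡b)
    a+i<n : a + i < n
    a+i<n = subst (a + i <_) (sym n≡) (+-monoˡ-< i a<b)
    gap′≡c : n ∸ (a + i) ≡ c
    gap′≡c = trans (cong (_∸ (a + i)) n≡) (trans ([m+o]∸[n+o]≡m∸n b a i) (m+n∸m≡n a c))
    c∉X : c ∉ X
    c∉X (here c≡a) = a≢c (sym c≡a)
    c∉X (there (here c≡b)) = <-irrefl c≡b (m<n+m c (s≤s z≤n))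
    c∉X (there (there (here c≡m))) = <-irrefl c≡m (<-trans (m<n+m c (s≤s z≤n)) b<m)

  value-isNimSequence : a ≢ c → IsNimSequence X value
  value-isNimSequence a≢c = record
    { no-move-between-equal = value-distinct ; move-to-each-smaller = value-complete a≢c }

  module _ {p : ℕ} (label-period : ∀ n → label (p + n) ≡ label n) where

    starts-+ : ∀ i → starts (p + i) ≡ starts p + starts i
    starts-+ zero = trans (cong starts (+-identityʳ p)) (sym (+-identityʳ (starts p)))
    starts-+ (suc i) = begin
      starts (p + suc i)                    ≡⟨ cong starts (+-suc p i) ⟩
      isS (label (p + i)) + starts (p + i)  ≡⟨ cong₂ _+_ (cong isS (label-period i)) (starts-+ i) ⟩
      isS (label i) + (starts p + starts i) ≡⟨ x∙yz≈y∙xz (isS (label i)) (starts p) (starts i) ⟩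
      starts p + starts (suc i)             ∎
      where open ≡-Reasoning

    origin-+ : ∀ n → origin (p + n) ≡ p + origin n
    origin-+ n = trans (cong (λ l → (p + n) ∸ offset l) (label-period n))
                       (+-∸-assoc p (subst (offset (label n) ≤_) (offset+origin n) (m≤m+n _ _)))

    value-+ : ∀ n → value (n + p) ≡ value n + starts p
    value-+ n = begin
      value (n + p)             ≡⟨ cong value (+-comm n p) ⟩
      starts (origin (p + n))   ≡⟨ cong starts (origin-+ n) ⟩
      starts (p + origin n)     ≡⟨ starts-+ (origin n) ⟩
      starts p + value n        ≡⟨ +-comm (starts p) (value n) ⟩
      value n + starts p        ∎
      where open ≡-Reasoning

  G-arithmeticallyPeriodic : a ≢ c → ArithmeticallyPeriodic (G X)
  G-arithmeticallyPeriodic a≢c =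
    let (p , 0<p , label-period) = label-periodic
    in arithmeticallyPeriodic-resp (isNimSequence⇒≗G (value-isNimSequence a≢c))
         (p , starts p , 0<p , value-+ label-period)

swap-⊆ : ∀ a b → (a ∷ b ∷ a + b ∷ []) ⊆ (b ∷ a ∷ b + a ∷ [])
swap-⊆ a b (here refl) = there (here refl)
swap-⊆ a b (there (here refl)) = here refl
swap-⊆ a b (there (there (here refl))) = there (there (here (+-comm a b)))

G-arithmeticallyPeriodic-< : ∀ {a b} → 1 ≤ a → a < b → ArithmeticallyPeriodic (G (a ∷ b ∷ a + b ∷ []))
G-arithmeticallyPeriodic-< {suc a′} _ a<b with c′ , refl ← m<n⇒∃[o]n≡1+o+m a<b
  rewrite +-comm (suc c′) (suc a′) with suc a′ ≟ suc c′
... | yes refl = Multiples.G-arithmeticallyPeriodic (suc a′)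
... | no a≢c = Labelling.G-arithmeticallyPeriodic a′ c′ a≢c

mainTheorem4 : (a b : ℕ) → 1 ≤ a → 1 ≤ b → a ≢ b →
    ∃₂ λ (p s : ℕ) → 1 ≤ p ×
      ((n : ℕ) → G (a ∷ b ∷ a + b ∷ []) (n + p) ≡ G (a ∷ b ∷ a + b ∷ []) n + s)
mainTheorem4 a b 1≤a 1≤b a≢b with <-cmp a b
... | tri< a<b _ _ = G-arithmeticallyPeriodic-< 1≤a a<b
... | tri≈ _ a≡b _ = contradiction a≡b a≢b
... | tri> _ _ b<a =
  arithmeticallyPeriodic-resp (G-cong (swap-⊆ a b) (swap-⊆ b a)) (G-arithmeticallyPeriodic-< 1≤b b<a)
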